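{- Let $M_1=(X,\mathcal{I}_1)$ be a matroid and $M_2,\ldots,M_k$ partition matroids on $X$; let $\alpha=\chi(M_1)$ and $B=\sum_{i=2}^k(\chi(M_i)-1)$. Let $c$ be a feasible coloring of some elements of $M=\bigcap_{i=1}^kM_i$ with colors in $[\alpha+B]$, let $G$ be the Edmonds digraph of $M_1$ with respect to $c$ (with $\alpha+B$ colors), and let $H$ be the color-chordless subgraph of $G$. Then every source-sink path in $H$ is a color-chordless path in $G$.
   Context: Coloring $c:X\to\{0,1,\ldots,\alpha+B\}$, $c(x)=0$ meaning uncolored; color classes $S_j=\{x:c(x)=j\}$; $c$ is feasible if each $S_j$ is independent in every $M_i$. $U$ = set of uncolored elements. Edmonds digraph $G=(V,A)$ with $V=[\alpha+B]\cup X$ (color vertices disjoint from $X$) and $A=\bigcup_jA_j$, where $A_j$ contains $(j,x)$ for every $x\notin S_j$ with $S_j\cup\{x\}\in\mathcal{I}_1$, and, for each $x\notin S_j$ with $S_j\cup\{x\}\notin\mathcal{I}_1$, the arc $(y,x)$ for each $y\in S_j$ with $S_j-\{y\}\cup\{x\}\in\mathcal{I}_1$. Sources are the color vertices, sinks the elements of $U$; a source-sink path goes from a source to a sink. The color of a color vertex $j$ is $j$; the color of an element $x$ is $c(x)$. A color-chord of a path $(x_1,\ldots,x_\ell)$ is an arc $(x_j,x_k)\in A$ between elements $x_j,x_k\in X$ with $1\le j\le k-2$ and $x_j$ having the same color as $x_{k-1}$; color-chordless means no color-chord. Color-chordless subgraph $H$: its vertices are partitioned into layers $L_0,L_1,\ldots$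 defined inductively: $L_0=[\alpha+B]$ (no arcs enter $L_0$); $L_t$ is the set of vertices $x$ not in $L_0\cup\cdots\cup L_{t-1}$ that have incoming arcs in $G$ from vertices of earlier layers having at least $B+1$ distinct colors. For each such $x$, choose vertices $y_1,\ldots,y_{B+1}$ in earlier layers with pairwise distinct colors, each with $(y_s,x)\in A$, such that for each $s$ there is no vertex $z$ of the same color as $y_s$ in a layer earlier than that of $y_s$ with $(z,x)\in A$; the arcs $(y_1,x),\ldots,(y_{B+1},x)$ are the arcs of $H$ entering $x$. Layers are added until no new vertex qualifies. -}

module Defs where

open import Data.Nat using (ℕ; zero; suc; _+_; _∸_; _≤_; _<_)
open import Data.Fin using (Fin; zero; suc; toℕ; inject₁; fromℕ; _≟_)
open import Data.Fin.Subset using (Subset; _∈_; _∉_; _⊆_; _∪_; _∩_; _-_; ⁅_⁆; ∣_∣) renaming (⊥ to ∅)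
open import Data.Vec using (tabulate)
open import Data.Maybe using (Maybe; just; nothing)
open import Data.Sum using (_⊎_; inj₁; inj₂)
open import Data.Product using (Σ; _×_; _,_; ∃; ∃-syntax)
open import Data.Empty using (⊥)
open import Data.Unit using (⊤)
open import Relation.Nullary using (¬_)
open import Relation.Nullary.Decidable using (⌊_⌋)
open import Relation.Binary.PropositionalEquality using (_≡_; _≢_)

-- Ground set X = Fin n; subsets of X are  Subset n  (= Vec Bool n).

record Matroid (n : ℕ) : Set₁ where
  field
    Indep    : Subset n → Set
    indep-∅  : Indep ∅
    indep-⊆  : ∀ {I J} → I ⊆ J → Indep J → Indep I
    exchange : ∀ {I J} → Indep I → Indep J → ∣ I ∣ < ∣ J ∣ →
               ∃[ x ] (x ∈ J × x ∉ I × Indep (I ∪ ⁅ x ⁆))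

fiber : ∀ {n m} → (Fin n → Fin m) → Fin m → Subset n
fiber f j = tabulate (λ x → ⌊ f x ≟ j ⌋)

record PartitionMatroid (n : ℕ) : Set where
  field
    nblocks : ℕ
    blockOf : Fin n → Fin nblocks
    cap     : Fin nblocks → ℕ

PIndep : ∀ {n} → PartitionMatroid n → Subset n → Set
PIndep P I = ∀ b → ∣ I ∩ fiber blockOf b ∣ ≤ cap b
  where open PartitionMatroid P

Colorable : ∀ {n} → (Subset n → Set) → ℕ → Set
Colorable {n} Indep m = Σ (Fin n → Fin m) λ f → ∀ j → Indep (fiber f j)

IsChromaticNumber : ∀ {n} → (Subset n → Set) → ℕ → Set
IsChromaticNumber Indep χ = Colorable Indep χ × (∀ m → Colorable Indep m → χ ≤ m)

sumFin : ∀ k → (Fin k → ℕ) → ℕ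
sumFin zero    f = 0
sumFin (suc k) f = f zero + sumFin k (λ i → f (suc i))

-- N = α + B is the number of colors; a coloring is c : Fin n → Fin (suc N)
-- where  zero  means "uncolored" and color j ∈ [N] is  suc j'.

module Edmonds {n : ℕ} (Indep : Subset n → Set) (N : ℕ) (c : Fin n → Fin (suc N)) where

  S : Fin (suc N) → Subset n
  S j = fiber c j

  -- vertex set V = [N] ⊎ X  (color vertices ⊎ elements)
  V : Set
  V = Fin N ⊎ Fin n

  colorOf : V → Fin (suc N)
  colorOf (inj₁ j) = suc j
  colorOf (inj₂ x) = c x

  IsElem : V → Set
  IsElem (inj₁ _) = ⊥
  IsElem (inj₂ _) = ⊤

  Arc : V → V → Set
  Arc _        (inj₁ _) = ⊥
  Arc (inj₁ j) (inj₂ x) = x ∉ S (suc j) × Indep (S (suc j) ∪ ⁅ x ⁆)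
  Arc (inj₂ y) (inj₂ x) =
    Σ (Fin N) λ j → c y ≡ suc j × x ∉ S (suc j) × ¬ Indep (S (suc j) ∪ ⁅ x ⁆)
                    × Indep ((S (suc j) - y) ∪ ⁅ x ⁆)

  _≺_ : (V → Maybe ℕ) → V → V → Set
  _≺_ layer u v = Σ ℕ λ a → Σ ℕ λ b → layer u ≡ just a × layer v ≡ just b × a < b

  Qualifies : ℕ → (V → Maybe ℕ) → ℕ → Fin n → Set
  Qualifies B layer t x =
    Σ (Fin (suc B) → V) λ y →
      (∀ s s' → colorOf (y s) ≡ colorOf (y s') → s ≡ s')
      × (∀ s → Arc (y s) (inj₂ x))
      × (∀ s → Σ ℕ λ a → layer (y s) ≡ just a × a ≤ t)

  -- The color-chordless subgraph H (for parameter B): its layer function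
  -- (nothing = not a vertex of H) and its arc relation, satisfying the
  -- inductive definition, for some admissible choice of the entering arcs.
  record ColorChordlessSubgraph (B : ℕ) : Set₁ where
    field
      layer  : V → Maybe ℕ
      HArc   : V → V → Set
      layer-color : ∀ j → layer (inj₁ j) ≡ just 0
      layer-elem  : ∀ x →
        (layer (inj₂ x) ≡ nothing × (∀ t → ¬ Qualifies B layer t x))
        ⊎ (Σ ℕ λ t → layer (inj₂ x) ≡ just (suc t) × Qualifies B layer t x
                     × (∀ t' → t' < t → ¬ Qualifies B layer t' x))
      HArc-color : ∀ u j → ¬ HArc u (inj₁ j)
      HArc-out   : ∀ u x → layer (inj₂ x) ≡ nothing → ¬ HArc u (inj₂ x)
      HArc-in    : ∀ x t → layer (inj₂ x) ≡ just (suc t) →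
        Σ (Fin (suc B) → V) λ y →
          (∀ s s' → colorOf (y s) ≡ colorOf (y s') → s ≡ s')
          × (∀ s → Arc (y s) (inj₂ x))
          × (∀ s → _≺_ layer (y s) (inj₂ x))
          × (∀ s z → colorOf z ≡ colorOf (y s) → Arc z (inj₂ x) → ¬ _≺_ layer z (y s))
          × (∀ u → HArc u (inj₂ x) → Σ (Fin (suc B)) λ s → y s ≡ u)
          × (∀ s → HArc (y s) (inj₂ x))

  record SourceSinkPath (R : V → V → Set) : Set where
    field
      len    : ℕ
      vtx    : Fin (suc len) → V
      simple : ∀ i j → vtx i ≡ vtx j → i ≡ j
      arcs   : ∀ (i : Fin len) → R (vtx (inject₁ i)) (vtx (suc i))
      source : Σ (Fin N) λ j → vtx zero ≡ inj₁ j
      sink   : Σ (Fin n) λ u → vtx (fromℕ len) ≡ inj₂ u × c u ≡ zero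

  -- color-chordless in G: no arc (v_i , v_{k+1}) of G between elements
  -- with i ≤ (k+1) - 2 and colorOf v_i = colorOf v_k.
  ColorChordless : ∀ {R} → SourceSinkPath R → Set
  ColorChordless P =
    ∀ (i : Fin (suc len)) (k : Fin len) → toℕ i < toℕ k →
      IsElem (vtx i) → IsElem (vtx (suc k)) →
      colorOf (vtx i) ≡ colorOf (vtx (inject₁ k)) →
      ¬ Arc (vtx i) (vtx (suc k))
    where open SourceSinkPath P

Feasible : ∀ {n k N} → Matroid n → (Fin k → PartitionMatroid n) →
           (Fin n → Fin (suc N)) → Set
Feasible M Ps c = ∀ j → Matroid.Indep M (fiber c (suc j))
                       × (∀ i → PIndep (Ps i) (fiber c (suc j)))

{-# OPTIONS --safe #-}
-- Every arc of H leads from an earlier layer to a later one, so along a path of H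
-- the layers strictly increase.  A color-chord (x_j, x_k) would therefore be an
-- arc of G entering x_k from a vertex with the color of x_{k-1} lying in an
-- earlier layer than x_{k-1}; but the arc (x_{k-1}, x_k) of H was chosen so that
-- no such vertex exists.
module Submission where

open import Defs
open import Data.Nat as ℕ using (ℕ; suc; _+_; _∸_; s≤s; z≤n)
open import Data.Nat.Properties using (<-trans)
open import Data.Fin using (Fin; zero; suc; inject₁; _<_)
open import Data.Fin.Properties using (toℕ-inject₁)
open import Data.Fin.Subset using (Subset)
open import Data.Maybe using (just)
open import Data.Maybe.Properties using (just-injective)
open import Data.Sum using (inj₁; inj₂)
open import Data.Product using (Σ; _,_)
open import Data.Empty using (⊥-elim)
open import Level using (0ℓ)
open import Relation.Nullary using (¬_)
open import Relation.Binary.Core using (Rel; _⇒_)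
open import Relation.Binary.Definitions using (Transitive)
open import Relation.Binary.PropositionalEquality using (_≡_; refl; sym; trans; subst)

module _ {V : Set} {R T : Rel V 0ℓ} (R⇒T : R ⇒ T) (T-trans : Transitive T) where

  chain⇒related : ∀ {len} (vtx : Fin (suc len) → V) →
                  (∀ i → R (vtx (inject₁ i)) (vtx (suc i))) →
                  ∀ {i j} → i < j → T (vtx i) (vtx j)
  chain⇒related {suc _} vtx arcs {zero} {suc zero} _ = R⇒T (arcs zero)
  chain⇒related {suc _} vtx arcs {zero} {suc (suc j)} _ =
    T-trans (R⇒T (arcs zero))
            (chain⇒related (λ i → vtx (suc i)) (λ i → arcs (suc i)) {zero} {suc j} (s≤s z≤n))
  chain⇒related {suc _} vtx arcs {suc i} {suc j} (s≤s i<j) =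
    chain⇒related (λ i → vtx (suc i)) (λ i → arcs (suc i)) i<j

module ColorChordlessSubgraphProperties
  {n N B : ℕ} {Indep : Subset n → Set} {c : Fin n → Fin (suc N)}
  (H : Edmonds.ColorChordlessSubgraph Indep N c B) where

  open Edmonds Indep N c
  open ColorChordlessSubgraph H

  ≺-trans : Transitive (_≺_ layer)
  ≺-trans (a , b , ea , eb , a<b) (b' , _ , eb' , ec , b'<c)
    with just-injective (trans (sym eb) eb')
  ... | refl = a , _ , ea , ec , <-trans a<b b'<c

  HArc⇒layer : ∀ {u x} → HArc u (inj₂ x) → Σ ℕ λ t → layer (inj₂ x) ≡ just (suc t)
  HArc⇒layer {u} {x} h with layer-elem x
  ... | inj₁ (out , _)    = ⊥-elim (HArc-out u x out h)
  ... | inj₂ (t , eq , _) = t , eq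

  HArc⇒≺ : HArc ⇒ _≺_ layer
  HArc⇒≺ {u} {inj₁ j} h = ⊥-elim (HArc-color u j h)
  HArc⇒≺ {u} {inj₂ x} h with HArc⇒layer h
  ... | t , eq with HArc-in x t eq
  ... | y , _ , _ , y≺x , _ , entering , _ with entering u h
  ... | s , refl = y≺x s

  HArc-source-minimal : ∀ {u v w} → HArc u v → colorOf w ≡ colorOf u → Arc w v →
                        ¬ _≺_ layer w u
  HArc-source-minimal {u} {inj₂ x} {w} h same-color a with HArc⇒layer h
  ... | t , eq with HArc-in x t eq
  ... | y , _ , _ , _ , minimal , entering , _ with entering u h
  ... | s , refl = minimal s w same-color a

  sourceSinkPath-colorChordless : (P : SourceSinkPath HArc) → ColorChordless P
  sourceSinkPath-colorChordless P i k i<k _ _ same-color chord =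
    HArc-source-minimal (arcs k) same-color chord
      (chain⇒related {R = HArc} {T = _≺_ layer} HArc⇒≺ ≺-trans vtx arcs
        (subst (_ ℕ.<_) (sym (toℕ-inject₁ k)) i<k))
    where open SourceSinkPath P

lemma4p3 : ∀ {n k'} (M₁ : Matroid n) (Ps : Fin k' → PartitionMatroid n)
    (α : ℕ) (χs : Fin k' → ℕ) →
    IsChromaticNumber (Matroid.Indep M₁) α →
    (∀ i → IsChromaticNumber (PIndep (Ps i)) (χs i)) →
    let B = sumFin k' (λ i → χs i ∸ 1) in
    (c : Fin n → Fin (suc (α + B))) →
    Feasible M₁ Ps c →
    (H : Edmonds.ColorChordlessSubgraph (Matroid.Indep M₁) (α + B) c B) →
    (P : Edmonds.SourceSinkPath (Matroid.Indep M₁) (α + B) c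
    (Edmonds.ColorChordlessSubgraph.HArc H)) →
    Edmonds.ColorChordless (Matroid.Indep M₁) (α + B) c P
lemma4p3 _ _ _ _ _ _ _ _ H =
  ColorChordlessSubgraphProperties.sourceSinkPath-colorChordless H
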